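{- Let $\mathcal{L}=(S,\iota,\rightarrow)$ be an LTS and let $\mathsf{norm}_{\mathsf{fdr}}(\mathcal{L})=(S',\iota',\rightarrow')$ be its failures-divergences normal form. For all sequences $\rho\in\mathit{Act}^*$ such that either $\rho\notin\mathsf{divergences}(\mathcal{L})$ or $\rho\in\mathsf{divergences}_{\mathsf{min}}(\mathcal{L})$, and for all states $s\in S$ such that $\iota\overset{\rho}{\Longrightarrow}s$, there is a state $U\in S'$ such that $s\in U$ and $\iota'\overset{\rho}{\twoheadrightarrow}{}'U$.
   Context: Fix a finite set $\mathit{Act}$ of actions not containing the internal action $\tau$; $\mathit{Act}_\tau=\mathit{Act}\cup\{\tau\}$. An LTS is $(S,\iota,\rightarrow)$ with $\iota\in S$ and $\rightarrow\subseteq S\times\mathit{Act}_\tau\times S$. For $\sigma\in\mathit{Act}_\tau^*$, $s\overset{\sigma}{\twoheadrightarrow}t$ means there is a path from $s$ to $t$ whose labels, in order, form exactly $\sigma$ (with $s\overset{\epsilon}{\twoheadrightarrow}t$ iff $s=t$). The weak transition relation $\Longrightarrow\subseteq S\times\mathit{Act}^*\times S$ is the smallest relation with $s\overset{\epsilon}{\Longrightarrow}s$; $s\overset{\epsilon}{\Longrightarrow}t$ if $s\xrightarrow{\tau}t$; $s\overset{a}{\Longrightarrow}t$ if $s\xrightarrow{a}t$ ($a\in\mathit{Act}$); $s\overset{\rho\sigma}{\Longrightarrow}t$ if $s\overset{\rho}{\Longrightarrow}u\overset{\sigma}{\Longrightarrow}t$. A state $s$ diverges if there is an infinite sequence $s\xrightarrow{\tau}s_1\xrightarrow{\tau}s_2\xrightarrow{\tau}\cdots$.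 $\mathsf{divergences}(\mathcal{L})=\{\rho\sigma\in\mathit{Act}^*\mid \exists t: \iota\overset{\rho}{\Longrightarrow}t \text{ and } t \text{ diverges}\}$ (with $\rho,\sigma\in\mathit{Act}^*$). $\mathsf{divergences}_{\mathsf{min}}(\mathcal{L})$ is the set of those $\rho\in\mathsf{divergences}(\mathcal{L})$ no strict prefix of which lies in $\mathsf{divergences}(\mathcal{L})$. The failures-divergences normal form $\mathsf{norm}_{\mathsf{fdr}}(\mathcal{L})=(S',\iota',\rightarrow')$ has $S'=\mathcal{P}(S)$, $\iota'=\{s\in S\mid \iota\overset{\epsilon}{\Longrightarrow}s\}$, and for all $U,V\subseteq S$ and $a\in\mathit{Act}$: $U\xrightarrow{a}{}'V$ iff no state of $U$ diverges and $V=\{t\in S\mid \exists s\in U: s\overset{a}{\Longrightarrow}t\}$. -}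

module Defs where

open import Data.Nat using (ℕ; suc)
open import Data.Fin using (Fin)
open import Data.Maybe using (Maybe; just; nothing)
open import Data.List using (List; []; _∷_; _++_)
open import Data.Product using (Σ; ∃; _×_; _,_)
open import Relation.Nullary using (¬_)
open import Relation.Binary.PropositionalEquality using (_≡_)
open import Function.Bundles using (_↔_; _⇔_)

Actτ : Set → Set
Actτ Act = Maybe Act

τ : {Act : Set} → Actτ Act
τ = nothing

record LTS (Act : Set) : Set₁ where
  field
    State : Set
    init  : State
    _⟶[_]_ : State → Actτ Act → State → Set
open LTS public

module _ {Act : Set} (L : LTS Act) where
  private
    S = State L
    _⟶_⟶_ : S → Actτ Act → S → Set
    s ⟶ a ⟶ t = LTS._⟶[_]_ L s a t

  data _=[_]⇒_ : S → List Act → S → Set where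
    w-refl : ∀ {s} → s =[ [] ]⇒ s
    w-tau  : ∀ {s t} → s ⟶ τ ⟶ t → s =[ [] ]⇒ t
    w-act  : ∀ {s t a} → s ⟶ just a ⟶ t → s =[ a ∷ [] ]⇒ t
    w-seq  : ∀ {s u t ρ σ} → s =[ ρ ]⇒ u → u =[ σ ]⇒ t → s =[ ρ ++ σ ]⇒ t

  Diverges : S → Set
  Diverges s = Σ (ℕ → S) λ f → (f 0 ≡ s) × (∀ n → f n ⟶ τ ⟶ f (suc n))

  divergences : List Act → Set
  divergences w = Σ (List Act) λ ρ → Σ (List Act) λ σ →
    (w ≡ ρ ++ σ) × ∃ λ t → (init L =[ ρ ]⇒ t) × Diverges t

  StrictPrefix : List Act → List Act → Set
  StrictPrefix p w = Σ (List Act) λ q → Σ Act λ a → w ≡ p ++ (a ∷ q)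

  divergences-min : List Act → Set
  divergences-min ρ = divergences ρ × (∀ p → StrictPrefix p ρ → ¬ divergences p)

  -- Failures-divergences normal form.  States are subsets of S,
  -- represented as predicates S → Set (equality of subsets = extensional).
  Subset : Set₁
  Subset = S → Set

  norm-init : Subset
  norm-init s = init L =[ [] ]⇒ s

  _⟶N[_]_ : Subset → Act → Subset → Set
  U ⟶N[ a ] V = (∀ s → U s → ¬ Diverges s)
              × (∀ t → V t ⇔ (∃ λ s → U s × (s =[ a ∷ [] ]⇒ t)))

  data _↠N[_]_ : Subset → List Act → Subset → Set₁ where
    p-nil  : ∀ {U} → U ↠N[ [] ] U
    p-cons : ∀ {U V W a σ} → U ⟶N[ a ] V → V ↠N[ σ ] W → U ↠N[ a ∷ σ ] W

module Submission where

-- For a set X of states and a word ρ let  reach X ρ  be the set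
-- obtained from X by repeatedly taking weak a-successors along ρ; these are
-- exactly the sets the normal form visits, since  U ⟶N[a] V  forces V to be
-- the weak a-successor set of U.
-- The theorem follows by taking U = reach ι' ρ.

open import Defs
open import Data.Nat using (ℕ)
open import Data.Fin using (Fin)
open import Data.List using (List; []; _∷_; _++_)
open import Data.List.Properties using (++-assoc; ++-identityʳ)
open import Data.Product using (Σ; _×_; _,_; ∃)
open import Data.Sum using (_⊎_; inj₁; inj₂)
open import Relation.Nullary using (¬_)
open import Relation.Binary.PropositionalEquality using (_≡_; refl; sym; trans; cong; subst)
open import Function.Bundles using (_↔_; mk⇔)

module _ {Act : Set} (L : LTS Act) where
  private
    S = State L

    infix 4 _⟹[_]_
    _⟹[_]_ : S → List Act → S → Set
    _⟹[_]_ = _=[_]⇒_ L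

  after : Subset L → Act → Subset L
  after X a t = ∃ λ s → X s × s ⟹[ a ∷ [] ] t

  reach : Subset L → List Act → Subset L
  reach X []      = X
  reach X (a ∷ ρ) = reach (after X a) ρ

  reach-++ : ∀ X ρ σ → reach X (ρ ++ σ) ≡ reach (reach X ρ) σ
  reach-++ X []      σ = refl
  reach-++ X (a ∷ ρ) σ = reach-++ (after X a) ρ σ

  Saturated : Subset L → Set
  Saturated X = ∀ x y → X x → x ⟹[ [] ] y → X y

  after-saturated : ∀ X a → Saturated (after X a)
  after-saturated X a x y (s , Xs , s⇒x) x⇒y = s , Xs , w-seq s⇒x x⇒y

  reach-saturated : ∀ X ρ → Saturated X → Saturated (reach X ρ)
  reach-saturated X []      sat = sat
  reach-saturated X (a ∷ ρ) sat = reach-saturated (after X a) ρ (after-saturated X a)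

  norm-init-saturated : Saturated (norm-init L)
  norm-init-saturated x y ι⇒x x⇒y = w-seq ι⇒x x⇒y

  -- Completeness: a weak σ-move from a member of a saturated X lands in reach X σ.
  -- Saturation is what absorbs the τ-steps of the weak transition.
  reach-complete : ∀ {u σ t} → u ⟹[ σ ] t →
                   ∀ X → Saturated X → X u → reach X σ t
  reach-complete w-refl       X sat Xu = Xu
  reach-complete (w-tau step) X sat Xu = sat _ _ Xu (w-tau step)
  reach-complete (w-act step) X sat Xu = _ , Xu , w-act step
  reach-complete (w-seq {ρ = ρ} {σ = σ} u⇒v v⇒t) X sat Xu =
    subst (λ Y → Y _) (sym (reach-++ X ρ σ))
      (reach-complete v⇒t (reach X ρ) (reach-saturated X ρ sat)
        (reach-complete u⇒v X sat Xu))

  reach-sound : ∀ X ρ t → reach X ρ t → ∃ λ u → X u × u ⟹[ ρ ] t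
  reach-sound X []      t Xt = t , Xt , w-refl
  reach-sound X (a ∷ ρ) t reached with reach-sound (after X a) ρ t reached
  ... | v , (u , Xu , u⇒v) , v⇒t = u , Xu , w-seq u⇒v v⇒t

  -- The normal form follows reach U along σ, provided no state reached by a
  -- strict prefix of σ diverges (the side condition of each normal-form step).
  follow-reach : ∀ U σ →
    (∀ p → StrictPrefix L p σ → ∀ t → reach U p t → ¬ Diverges L t) →
    _↠N[_]_ L U σ (reach U σ)
  follow-reach U []      convergent = p-nil
  follow-reach U (a ∷ σ) convergent =
    p-cons (convergent [] (σ , a , refl) , λ t → mk⇔ (λ x → x) (λ x → x))
           (follow-reach (after U a) σ
             (λ p (q , b , σ≡) → convergent (a ∷ p) (q , b , cong (a ∷_) σ≡)))

  divergences-extend : ∀ p q → divergences L p → divergences L (p ++ q)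
  divergences-extend p q (ρ , σ , p≡ρσ , t , ι⇒t , div) =
    ρ , σ ++ q , trans (cong (_++ q) p≡ρσ) (++-assoc ρ σ q) , t , ι⇒t , div

  prefix-convergent : ∀ ρ → (¬ divergences L ρ ⊎ divergences-min L ρ) →
                      ∀ p → StrictPrefix L p ρ → ¬ divergences L p
  prefix-convergent ρ (inj₁ ρ∉div) p (q , a , ρ≡) p∈div =
    ρ∉div (subst (divergences L) (sym ρ≡) (divergences-extend p (a ∷ q) p∈div))
  prefix-convergent ρ (inj₂ (_ , minimal)) p prefix = minimal p prefix

  reach-divergence : ∀ p t → reach (norm-init L) p t → Diverges L t → divergences L p
  reach-divergence p t reached div with reach-sound (norm-init L) p t reached
  ... | u , ι⇒u , u⇒t = p , [] , sym (++-identityʳ p) , t , w-seq ι⇒u u⇒t , div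

lemma3p18 : {Act : Set} {n : ℕ} → Act ↔ Fin n → (L : LTS Act) →
    (ρ : List Act) → (¬ divergences L ρ ⊎ divergences-min L ρ) →
    (s : State L) → _=[_]⇒_ L (init L) ρ s →
    Σ (Subset L) λ U → U s × _↠N[_]_ L (norm-init L) ρ U
lemma3p18 _ L ρ hyp s ι⇒s =
  reach L (norm-init L) ρ ,
  reach-complete L ι⇒s (norm-init L) (norm-init-saturated L) w-refl ,
  follow-reach L (norm-init L) ρ
    (λ p prefix t reached div →
      prefix-convergent L ρ hyp p prefix (reach-divergence L p t reached div))
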